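{- For all integers $m\geq 5$ and $n\geq 6$ with $n\not\equiv 0 \pmod 5$, $\lambda_1^1(P_m \times C_n)=5$.
   Context: For a graph $G$, an $L(1,1)$-labeling with labels in $\{0,1,\dots,p\}$ is a function $l:V(G)\to\{0,1,\dots,p\}$ such that $l(u)\neq l(v)$ whenever the distance $d(u,v)$ is $1$ or $2$. $\lambda_1^1(G)$ denotes the least $p$ for which $G$ admits such a labeling. $P_m$ denotes the path with $m$ vertices and $C_n$ the cycle with $n$ vertices. The direct product $G\times H$ has vertex set $V(G)\times V(H)$, with $(x_1,x_2)$ adjacent to $(y_1,y_2)$ iff $x_1y_1\in E(G)$ and $x_2y_2\in E(H)$. -}

module Defs where

open import Data.Nat using (ℕ; zero; suc; _+_; _≤_; _<_)
open import Data.Nat.DivMod using (_%_)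
open import Data.Fin using (Fin; toℕ)
open import Data.Product using (_×_; _,_; Σ)
open import Data.Sum using (_⊎_)
open import Relation.Binary.PropositionalEquality using (_≡_; _≢_)
open import Relation.Nullary using (¬_)

record Graph : Set₁ where
  field
    V   : Set
    Adj : V → V → Set
open Graph public

Path : ℕ → Graph
Path m = record
  { V = Fin m
  ; Adj = λ i j → (suc (toℕ i) ≡ toℕ j) ⊎ (suc (toℕ j) ≡ toℕ i) }

Cycle : (n : ℕ) → Graph
Cycle zero = record { V = Fin zero ; Adj = λ _ _ → Fin zero }
Cycle (suc k) = record
  { V = Fin (suc k)
  ; Adj = λ i j → ((suc (toℕ i)) % (suc k) ≡ toℕ j)
                ⊎ ((suc (toℕ j)) % (suc k) ≡ toℕ i) }

_⊗_ : Graph → Graph → Graph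
G ⊗ H = record
  { V = V G × V H
  ; Adj = λ { (x₁ , x₂) (y₁ , y₂) → Adj G x₁ y₁ × Adj H x₂ y₂ } }

Within2 : (G : Graph) → V G → V G → Set
Within2 G u v = (u ≢ v) × (Adj G u v ⊎ Σ (V G) (λ w → Adj G u w × Adj G w v))

IsL11Labeling : (G : Graph) → (p : ℕ) → (V G → Fin (suc p)) → Set
IsL11Labeling G p l = ∀ u v → Within2 G u v → l u ≢ l v

HasL11 : Graph → ℕ → Set
HasL11 G p = Σ (V G → Fin (suc p)) (IsL11Labeling G p)

λ11≡ : Graph → ℕ → Set
λ11≡ G k = HasL11 G k × (∀ p → p < k → ¬ HasL11 G p)

-- Six labels suffice: give the vertex (r , c) of P_m × C_n the colour of row r mod P in a
-- column of type σ c. Such a labeling is an L(1,1)-labeling as soon as every three cyclically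
-- consecutive columns satisfy six inequalities per row residue, which is decided by
-- computation. For n = 6, 7, 8, 11 one column is listed per position; every other n ≢ 0
-- (mod 5) with n ≥ 6 is w + 5a with w ∈ {9, 12, 13, 16}, and a tail of w columns followed by
-- a copies of a fixed block of five columns works, because the inequalities only have to be
-- checked along the finitely many transitions between column types.
--
-- Five labels do not suffice: in rows 0–4, the labels on a zigzag (rows 0, 2, 4 of column j
-- and rows 1, 3 of column j + 1) constrain those on the zigzag two columns further so strongly
-- that an exhaustive search shows row 0 to be periodic with period 10. As 5 ∤ n there is t with
-- 10 t ≡ 2 (mod n), so the vertices (0 , 0) and (0 , 2), at distance 2, would get the same label.

module Submission where

open import Defs
open import Data.Empty using (⊥-elim)
open import Data.Fin using (Fin; toℕ; #_)
open import Data.Fin.Properties using (toℕ-fromℕ<; toℕ-injective; toℕ<n; fromℕ<-cong)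
  renaming (_≟_ to _≟ᶠ_)
open import Data.List using (List; []; _∷_; filter; upTo)
open import Data.List.Membership.Propositional using (_∈_)
open import Data.List.Membership.Propositional.Properties using (∈-filter⁺; ∈-upTo⁺)
open import Data.List.Relation.Unary.All as All using (All; []; _∷_)
open import Data.List.Relation.Unary.Any using (here; there)
open import Data.Nat using (ℕ; zero; suc; _+_; _*_; _∸_; _≤_; _<_; _%_; _/_; _≟_; _<?_;
  z≤n; s≤s; s≤s⁻¹; z<s; NonZero)
open import Data.Nat.DivMod using (_mod_; m%n<n; m%n%n≡m%n; %-distribˡ-+; m<n⇒m%n≡m;
  m≤n⇒[n∸m]%m≡n%m; [m+n]%n≡m%n; [m+kn]%n≡m%n; n%n≡0; m≡m%n+[m/n]*n)
open import Data.Nat.Properties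
open import Data.Nat.Tactic.RingSolver using (solve-∀)
open import Data.Product using (_×_; _,_; proj₁; proj₂; uncurry; ∃-syntax)
open import Data.Sum using (_⊎_; inj₁; inj₂; [_,_]; swap)
open import Data.Vec using (Vec; lookup; _++_)
open import Function using (id)
open import Relation.Binary using (tri<; tri≈; tri>)
open import Relation.Binary.PropositionalEquality hiding ([_])
open import Relation.Nullary using (¬_; Dec; yes; no; ¬?; contradiction)
open import Relation.Nullary.Decidable using (True; toWitness)

[m+n%d]%d≡[m+n]%d : ∀ m n d .{{_ : NonZero d}} → (m + n % d) % d ≡ (m + n) % d
[m+n%d]%d≡[m+n]%d m n d = begin
  (m + n % d) % d           ≡⟨ %-distribˡ-+ m (n % d) d ⟩
  (m % d + n % d % d) % d   ≡⟨ cong (λ x → (m % d + x) % d) (m%n%n≡m%n n d) ⟩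
  (m % d + n % d) % d       ≡⟨ %-distribˡ-+ m n d ⟨
  (m + n) % d               ∎
  where open ≡-Reasoning

[m+n]%d≢n : ∀ {m n d} .{{_ : NonZero d}} → 0 < m → m < d → n < d → (m + n) % d ≢ n
[m+n]%d≢n {m} {n} {d} 0<m m<d n<d eq with m + n <? d
... | yes m+n<d = <⇒≢ (m<n+m n 0<m) (sym (trans (sym (m<n⇒m%n≡m m+n<d)) eq))
... | no  m+n≮d = <⇒≢ m<d (+-cancelʳ-≡ n m d (begin
  m + n          ≡⟨ m∸n+n≡m d≤m+n ⟨
  m + n ∸ d + d  ≡⟨ cong (_+ d) reduced ⟩
  n + d          ≡⟨ +-comm n d ⟩
  d + n          ∎))
  where
  open ≡-Reasoning
  d≤m+n : d ≤ m + n
  d≤m+n = ≮⇒≥ m+n≮d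
  reduced : m + n ∸ d ≡ n
  reduced = begin
    m + n ∸ d        ≡⟨ m<n⇒m%n≡m (m<n+o⇒m∸n<o (m + n) d (+-mono-< m<d n<d)) ⟨
    (m + n ∸ d) % d  ≡⟨ m≤n⇒[n∸m]%m≡n%m d≤m+n ⟩
    (m + n) % d      ≡⟨ eq ⟩
    n                ∎

-- Distance at most 2 in P_m × C_n

OneApart : (ℕ → ℕ) → ℕ → ℕ → Set
OneApart f a b = f a ≡ b ⊎ f b ≡ a

data TwoApart (f : ℕ → ℕ) : ℕ → ℕ → Set where
  forward  : ∀ a → TwoApart f a (f (f a))
  stay     : ∀ a → TwoApart f a a
  backward : ∀ a → TwoApart f (f (f a)) a

two-apart : ∀ {f a b c} → (f a ≡ f c → a ≡ c) → OneApart f a b → OneApart f b c → TwoApart f a c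
two-apart inj (inj₁ refl) (inj₁ refl) = forward _
two-apart inj (inj₁ refl) (inj₂ fc≡fa) rewrite inj (sym fc≡fa) = stay _
two-apart inj (inj₂ refl) (inj₁ refl) = stay _
two-apart inj (inj₂ refl) (inj₂ refl) = backward _

-- Cycle lengths are written suc k so that the adjacency relation of Cycle computes.
module Cylinder (k : ℕ) where

  n : ℕ
  n = suc k

  next : ℕ → ℕ
  next c = suc c % n

  next-injective : ∀ {c c′} → c < n → c′ < n → next c ≡ next c′ → c ≡ c′
  next-injective {c} {c′} c<n c′<n eq =
    trans (sym (prev-next c<n)) (trans (cong prev eq) (prev-next c′<n))
    where
    prev : ℕ → ℕ
    prev x = (k + x) % n
    prev-next : ∀ {x} → x < n → prev (next x) ≡ x
    prev-next {x} x<n = begin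
      (k + suc x % n) % n  ≡⟨ [m+n%d]%d≡[m+n]%d k (suc x) n ⟩
      (k + suc x) % n      ≡⟨ cong (_% n) (trans (+-suc k x) (+-comm n x)) ⟩
      (x + n) % n          ≡⟨ [m+n]%n≡m%n x n ⟩
      x % n                ≡⟨ m<n⇒m%n≡m x<n ⟩
      x                    ∎
      where open ≡-Reasoning

  data Near : ℕ → ℕ → ℕ → ℕ → Set where
    ↗  : ∀ r c → Near r c (suc r) (next c)
    ↘  : ∀ r c → Near (suc r) c r (next c)
    ↑↑ : ∀ r c → Near r c (2 + r) c
    →→ : ∀ r c → Near r c r (next (next c))
    ↗↗ : ∀ r c → Near r c (2 + r) (next (next c))
    ↘↘ : ∀ r c → Near (2 + r) c r (next (next c))

  Near± : ℕ → ℕ → ℕ → ℕ → Set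
  Near± r c r′ c′ = Near r c r′ c′ ⊎ Near r′ c′ r c

  one-apart⇒near : ∀ {r c r′ c′} → OneApart suc r r′ → OneApart next c c′ → Near± r c r′ c′
  one-apart⇒near (inj₁ refl) (inj₁ refl) = inj₁ (↗ _ _)
  one-apart⇒near (inj₂ refl) (inj₁ refl) = inj₁ (↘ _ _)
  one-apart⇒near (inj₁ refl) (inj₂ refl) = inj₂ (↘ _ _)
  one-apart⇒near (inj₂ refl) (inj₂ refl) = inj₂ (↗ _ _)

  two-apart⇒near : ∀ {r c r′ c′} → TwoApart suc r r′ → TwoApart next c c′ →
                   ¬ (r ≡ r′ × c ≡ c′) → Near± r c r′ c′
  two-apart⇒near (forward r)  (forward c)  _ = inj₁ (↗↗ r c)
  two-apart⇒near (forward r)  (stay c)     _ = inj₁ (↑↑ r c)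
  two-apart⇒near (forward r)  (backward c) _ = inj₂ (↘↘ r c)
  two-apart⇒near (stay r)     (forward c)  _ = inj₁ (→→ r c)
  two-apart⇒near (stay r)     (stay c)     ≠ = ⊥-elim (≠ (refl , refl))
  two-apart⇒near (stay r)     (backward c) _ = inj₂ (→→ r c)
  two-apart⇒near (backward r) (forward c)  _ = inj₁ (↘↘ r c)
  two-apart⇒near (backward r) (stay c)     _ = inj₂ (↑↑ r c)
  two-apart⇒near (backward r) (backward c) _ = inj₂ (↗↗ r c)

  within2⇒near : ∀ {m r c r′ c′} → Within2 (Path m ⊗ Cycle n) (r , c) (r′ , c′) →
                 Near± (toℕ r) (toℕ c) (toℕ r′) (toℕ c′)
  within2⇒near (_ , inj₁ (rows , cols)) = one-apart⇒near rows cols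
  within2⇒near {c = c} {c′ = c′} (≠ , inj₂ (_ , (rows₁ , cols₁) , (rows₂ , cols₂))) =
    two-apart⇒near (two-apart suc-injective rows₁ rows₂)
                   (two-apart (next-injective (toℕ<n c) (toℕ<n c′)) cols₁ cols₂)
                   (λ (r≡r′ , c≡c′) → ≠ (cong₂ _,_ (toℕ-injective r≡r′) (toℕ-injective c≡c′)))

-- Labelings by periodic columns

module Design {P K : ℕ} .{{_ : NonZero P}} .{{_ : NonZero K}} (table : Vec (Vec (Fin 6) P) K) where

  colour : ℕ → ℕ → Fin 6
  colour x ρ = lookup (lookup table (x mod K)) (ρ mod P)

  colour-periodic : ∀ x i ρ → colour x (i + ρ % P) ≡ colour x (i + ρ)
  colour-periodic x i ρ = cong (lookup (lookup table (x mod K)))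
    (fromℕ<-cong _ _ ([m+n%d]%d≡[m+n]%d i ρ P) (m%n<n (i + ρ % P) P) (m%n<n (i + ρ) P))

  colour-periodic-≢ : ∀ {x y} i j ρ → colour x (i + ρ % P) ≢ colour y (j + ρ % P) →
                      colour x (i + ρ) ≢ colour y (j + ρ)
  colour-periodic-≢ i j ρ ne eq =
    ne (trans (colour-periodic _ i ρ) (trans eq (sym (colour-periodic _ j ρ))))

  Distinct : List (Fin 6 × Fin 6) → Set
  Distinct = All (uncurry _≢_)

  -- One pair for each shape of Near, in the order ↗ ↘ ↑↑ →→ ↗↗ ↘↘.
  WindowAt : ℕ → ℕ → ℕ → ℕ → Set
  WindowAt x y z ρ = Distinct
    ( (colour x ρ , colour y (1 + ρ)) ∷ (colour x (1 + ρ) , colour y ρ) ∷ (colour x ρ , colour x (2 + ρ))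
    ∷ (colour x ρ , colour z ρ) ∷ (colour x ρ , colour z (2 + ρ)) ∷ (colour x (2 + ρ) , colour z ρ) ∷ [])

  Window : ℕ → ℕ → ℕ → Set
  Window x y z = ∀ {ρ} → ρ < P → WindowAt x y z ρ

  window? : ∀ x y z → Dec (Window x y z)
  window? x y z = allUpTo? (λ ρ → All.all? (λ (u , v) → ¬? (u ≟ᶠ v)) _) P

  module OnCylinder (k : ℕ) (σ : ℕ → ℕ) where
    open Cylinder k

    label : ∀ {m} → V (Path m ⊗ Cycle n) → Fin 6
    label (r , c) = colour (σ (toℕ c)) (toℕ r)

    Windows : Set
    Windows = ∀ {c} → c < n → Window (σ c) (σ (next c)) (σ (next (next c)))

    near-distinct : Windows → ∀ {r c r′ c′} → c < n → Near r c r′ c′ → colour (σ c) r ≢ colour (σ c′) r′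
    near-distinct W c<n (↗ r c) with W c<n (m%n<n r P)
    ... | ne ∷ _ = colour-periodic-≢ 0 1 r ne
    near-distinct W c<n (↘ r c) with W c<n (m%n<n r P)
    ... | _ ∷ ne ∷ _ = colour-periodic-≢ 1 0 r ne
    near-distinct W c<n (↑↑ r c) with W c<n (m%n<n r P)
    ... | _ ∷ _ ∷ ne ∷ _ = colour-periodic-≢ 0 2 r ne
    near-distinct W c<n (→→ r c) with W c<n (m%n<n r P)
    ... | _ ∷ _ ∷ _ ∷ ne ∷ _ = colour-periodic-≢ 0 0 r ne
    near-distinct W c<n (↗↗ r c) with W c<n (m%n<n r P)
    ... | _ ∷ _ ∷ _ ∷ _ ∷ ne ∷ _ = colour-periodic-≢ 0 2 r ne
    near-distinct W c<n (↘↘ r c) with W c<n (m%n<n r P)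
    ... | _ ∷ _ ∷ _ ∷ _ ∷ _ ∷ ne ∷ _ = colour-periodic-≢ 2 0 r ne

    windows⇒labeling : Windows → ∀ m → HasL11 (Path m ⊗ Cycle n) 5
    windows⇒labeling W m = label , λ where
      (r , c) (r′ , c′) w eq → [ (λ near → near-distinct W (toℕ<n c) near eq)
                               , (λ near → near-distinct W (toℕ<n c′) near (sym eq)) ] (within2⇒near w)

cyclic-labeling : ∀ {P k} .{{_ : NonZero P}} (table : Vec (Vec (Fin 6) P) (suc k)) →
  let open Design table; open Cylinder k in
  True (allUpTo? (λ c → window? c (next c) (next (next c))) n) → ∀ m → HasL11 (Path m ⊗ Cycle n) 5
cyclic-labeling table ok = Design.OnCylinder.windows⇒labeling table _ id (toWitness ok)

module Family (block : Vec (Vec (Fin 6) 5) 5) (w′ : ℕ) (tail : Vec (Vec (Fin 6) 5) (suc w′)) where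

  w K : ℕ
  w = suc w′
  K = 5 + w

  open Design (block ++ tail)

  -- Types 0 … 4 are the block columns and 5 … 4 + w the tail columns. Both are traversed in
  -- order, and after the last column of either one may start the block or the tail.
  successors : ℕ → List ℕ
  successors x with x ≟ 4 | x ≟ 5 + w′
  ... | no _ | no _ = suc x ∷ []
  ... | _    | _    = 0 ∷ 5 ∷ []

  block-successor : ∀ {x} → x < 5 → suc x % 5 ∈ successors x
  block-successor {0} _ = here refl
  block-successor {1} _ = here refl
  block-successor {2} _ = here refl
  block-successor {3} _ = here refl
  block-successor {4} _ = here refl
  block-successor {suc (suc (suc (suc (suc _))))} (s≤s (s≤s (s≤s (s≤s (s≤s ())))))

  tail-successor : ∀ {i} → i < w′ → 6 + i ∈ successors (5 + i)
  tail-successor {i} i<w′ with 5 + i ≟ 5 + w′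
  ... | yes eq = contradiction (+-cancelˡ-≡ 5 i w′ eq) (<⇒≢ i<w′)
  ... | no  _  = here refl

  successors-last : successors (5 + w′) ≡ 0 ∷ 5 ∷ []
  successors-last with 5 + w′ ≟ 5 + w′
  ... | yes _ = refl
  ... | no ne = contradiction refl ne

  TypeGraphWindows : Set
  TypeGraphWindows = ∀ {x} → x < K → All (λ y → All (Window x y) (successors y)) (successors x)

  typeGraphWindows? : Dec TypeGraphWindows
  typeGraphWindows? = allUpTo? (λ x → All.all? (λ y → All.all? (window? x y) _) _) K

  σ : ℕ → ℕ
  σ c with c <? w
  ... | yes _ = 5 + c
  ... | no  _ = (c ∸ w) % 5

  σ-tail : ∀ {c} → c < w → σ c ≡ 5 + c
  σ-tail {c} c<w with c <? w
  ... | yes _   = refl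
  ... | no  c≮w = contradiction c<w c≮w

  σ-block : ∀ {c} → w ≤ c → σ c ≡ (c ∸ w) % 5
  σ-block {c} w≤c with c <? w
  ... | yes c<w = contradiction w≤c (<⇒≱ c<w)
  ... | no  _   = refl

  σ<K : ∀ c → σ c < K
  σ<K c with c <? w
  ... | yes c<w = +-monoʳ-< 5 c<w
  ... | no  _   = <-≤-trans (m%n<n (c ∸ w) 5) (m≤m+n 5 w)

  σ-suc : ∀ c → σ (suc c) ∈ successors (σ c)
  σ-suc c with <-cmp (suc c) w
  ... | tri< sc<w _ _ rewrite σ-tail sc<w | σ-tail (<-trans (n<1+n c) sc<w) = tail-successor (s≤s⁻¹ sc<w)
  ... | tri≈ _ refl _ rewrite σ-block (≤-refl {w}) | σ-tail (n<1+n w′) | successors-last | n∸n≡0 w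
    = here refl
  ... | tri> _ _ w<sc rewrite σ-block (<⇒≤ w<sc) | σ-block (s≤s⁻¹ w<sc) | +-∸-assoc 1 (s≤s⁻¹ w<sc)
                        | sym ([m+n%d]%d≡[m+n]%d 1 (c ∸ w) 5) = block-successor (m%n<n (c ∸ w) 5)

  σ-last-block : ∀ a → σ (w′ + suc a * 5) ≡ 4
  σ-last-block a = begin
    σ (w′ + suc a * 5)          ≡⟨ σ-block (subst (_≤ w′ + suc a * 5) (+-comm w′ 1) (+-monoʳ-≤ w′ z<s)) ⟩
    (w′ + suc a * 5 ∸ w) % 5    ≡⟨ cong (λ x → (x ∸ w) % 5) (+-suc w′ (4 + a * 5)) ⟩
    (w + (4 + a * 5) ∸ w) % 5   ≡⟨ cong (_% 5) (m+n∸m≡n w (4 + a * 5)) ⟩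
    (4 + a * 5) % 5             ≡⟨ [m+kn]%n≡m%n 4 a 5 ⟩
    4                           ∎
    where open ≡-Reasoning

  σ-wrap : ∀ a → σ 0 ∈ successors (σ (w′ + a * 5))
  σ-wrap zero    rewrite σ-tail {0} z<s | +-identityʳ w′ | σ-tail (n<1+n w′) | successors-last
    = there (here refl)
  σ-wrap (suc a) rewrite σ-tail {0} z<s | σ-last-block a = there (here refl)

  module WithBlocks (a : ℕ) where
    open Cylinder (w′ + a * 5)

    σ-next : ∀ {c} → c < n → σ (next c) ∈ successors (σ c)
    σ-next {c} c<n with m≤n⇒m<n∨m≡n c<n
    ... | inj₁ sc<n rewrite m<n⇒m%n≡m sc<n = σ-suc c
    ... | inj₂ refl = subst (λ x → σ x ∈ successors (σ (w′ + a * 5))) (sym (n%n≡0 n)) (σ-wrap a)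

    windows : TypeGraphWindows → OnCylinder.Windows (w′ + a * 5) σ
    windows ok {c} c<n = All.lookup (All.lookup (ok (σ<K c)) (σ-next c<n)) (σ-next (m%n<n (suc c) n))

  family-labeling : True typeGraphWindows? → ∀ a m → HasL11 (Path m ⊗ Cycle (w + a * 5)) 5
  family-labeling ok a = OnCylinder.windows⇒labeling (w′ + a * 5) σ (WithBlocks.windows a (toWitness ok))

module Tables where
  open import Agda.Builtin.FromNat using (Number; fromNat)
  open import Data.Unit using (⊤; tt)
  open import Data.Vec using ([]; _∷_)
  import Data.Fin.Literals as Fin
  import Data.Nat.Literals as ℕ

  instance
    finLiterals : ∀ {n} → Number (Fin n)
    finLiterals {n} = Fin.number n
    natLiterals : Number ℕ
    natLiterals = ℕ.number
    trivial : ⊤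
    trivial = tt

  columns6 : Vec (Vec (Fin 6) 4) 6
  columns6 =
      (0 ∷ 1 ∷ 3 ∷ 4 ∷ []) ∷
      (0 ∷ 2 ∷ 3 ∷ 5 ∷ []) ∷
      (1 ∷ 2 ∷ 4 ∷ 5 ∷ []) ∷
      (1 ∷ 0 ∷ 4 ∷ 3 ∷ []) ∷
      (2 ∷ 0 ∷ 5 ∷ 3 ∷ []) ∷
      (2 ∷ 1 ∷ 5 ∷ 4 ∷ []) ∷
      []

  columns7 : Vec (Vec (Fin 6) 10) 7
  columns7 =
      (0 ∷ 5 ∷ 3 ∷ 3 ∷ 2 ∷ 2 ∷ 1 ∷ 4 ∷ 4 ∷ 0 ∷ []) ∷
      (3 ∷ 2 ∷ 2 ∷ 1 ∷ 1 ∷ 4 ∷ 0 ∷ 0 ∷ 5 ∷ 3 ∷ []) ∷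
      (1 ∷ 1 ∷ 4 ∷ 4 ∷ 0 ∷ 5 ∷ 3 ∷ 3 ∷ 2 ∷ 2 ∷ []) ∷
      (4 ∷ 0 ∷ 0 ∷ 3 ∷ 3 ∷ 2 ∷ 2 ∷ 1 ∷ 1 ∷ 4 ∷ []) ∷
      (3 ∷ 3 ∷ 2 ∷ 2 ∷ 1 ∷ 1 ∷ 4 ∷ 4 ∷ 0 ∷ 0 ∷ []) ∷
      (2 ∷ 1 ∷ 1 ∷ 4 ∷ 4 ∷ 0 ∷ 0 ∷ 5 ∷ 3 ∷ 2 ∷ []) ∷
      (4 ∷ 4 ∷ 0 ∷ 0 ∷ 5 ∷ 3 ∷ 3 ∷ 2 ∷ 1 ∷ 1 ∷ []) ∷
      []

  columns8 : Vec (Vec (Fin 6) 6) 8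
  columns8 =
      (0 ∷ 4 ∷ 3 ∷ 1 ∷ 2 ∷ 5 ∷ []) ∷
      (0 ∷ 2 ∷ 3 ∷ 0 ∷ 2 ∷ 3 ∷ []) ∷
      (1 ∷ 2 ∷ 4 ∷ 0 ∷ 5 ∷ 3 ∷ []) ∷
      (1 ∷ 5 ∷ 4 ∷ 1 ∷ 5 ∷ 4 ∷ []) ∷
      (0 ∷ 5 ∷ 3 ∷ 1 ∷ 2 ∷ 4 ∷ []) ∷
      (0 ∷ 2 ∷ 3 ∷ 0 ∷ 2 ∷ 3 ∷ []) ∷
      (1 ∷ 2 ∷ 5 ∷ 0 ∷ 4 ∷ 3 ∷ []) ∷
      (1 ∷ 4 ∷ 5 ∷ 1 ∷ 4 ∷ 5 ∷ []) ∷
      []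

  columns11 : Vec (Vec (Fin 6) 10) 11
  columns11 =
      (0 ∷ 1 ∷ 3 ∷ 5 ∷ 2 ∷ 4 ∷ 3 ∷ 0 ∷ 4 ∷ 3 ∷ []) ∷
      (5 ∷ 2 ∷ 4 ∷ 1 ∷ 0 ∷ 4 ∷ 3 ∷ 0 ∷ 1 ∷ 3 ∷ []) ∷
      (1 ∷ 2 ∷ 4 ∷ 3 ∷ 0 ∷ 1 ∷ 5 ∷ 5 ∷ 2 ∷ 4 ∷ []) ∷
      (3 ∷ 0 ∷ 1 ∷ 3 ∷ 5 ∷ 2 ∷ 4 ∷ 1 ∷ 2 ∷ 4 ∷ []) ∷
      (3 ∷ 5 ∷ 2 ∷ 0 ∷ 1 ∷ 2 ∷ 4 ∷ 3 ∷ 0 ∷ 0 ∷ []) ∷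
      (4 ∷ 1 ∷ 2 ∷ 4 ∷ 3 ∷ 0 ∷ 0 ∷ 3 ∷ 1 ∷ 2 ∷ []) ∷
      (4 ∷ 1 ∷ 0 ∷ 4 ∷ 3 ∷ 1 ∷ 2 ∷ 5 ∷ 1 ∷ 2 ∷ []) ∷
      (5 ∷ 3 ∷ 0 ∷ 2 ∷ 5 ∷ 1 ∷ 2 ∷ 4 ∷ 3 ∷ 0 ∷ []) ∷
      (2 ∷ 3 ∷ 1 ∷ 2 ∷ 4 ∷ 3 ∷ 0 ∷ 4 ∷ 3 ∷ 0 ∷ []) ∷
      (2 ∷ 4 ∷ 1 ∷ 0 ∷ 4 ∷ 3 ∷ 0 ∷ 2 ∷ 1 ∷ 5 ∷ []) ∷
      (0 ∷ 4 ∷ 3 ∷ 0 ∷ 2 ∷ 5 ∷ 5 ∷ 2 ∷ 4 ∷ 5 ∷ []) ∷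
      []

  block : Vec (Vec (Fin 6) 5) 5
  block =
      (0 ∷ 1 ∷ 2 ∷ 3 ∷ 4 ∷ []) ∷
      (3 ∷ 4 ∷ 0 ∷ 1 ∷ 2 ∷ []) ∷
      (1 ∷ 2 ∷ 3 ∷ 4 ∷ 0 ∷ []) ∷
      (4 ∷ 0 ∷ 1 ∷ 2 ∷ 3 ∷ []) ∷
      (2 ∷ 3 ∷ 4 ∷ 0 ∷ 1 ∷ []) ∷
      []

  tail9 : Vec (Vec (Fin 6) 5) 9
  tail9 =
      (0 ∷ 1 ∷ 2 ∷ 3 ∷ 4 ∷ []) ∷
      (3 ∷ 4 ∷ 0 ∷ 1 ∷ 2 ∷ []) ∷
      (1 ∷ 2 ∷ 3 ∷ 4 ∷ 0 ∷ []) ∷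
      (4 ∷ 0 ∷ 1 ∷ 2 ∷ 3 ∷ []) ∷
      (2 ∷ 3 ∷ 4 ∷ 0 ∷ 5 ∷ []) ∷
      (0 ∷ 5 ∷ 2 ∷ 1 ∷ 4 ∷ []) ∷
      (1 ∷ 4 ∷ 3 ∷ 5 ∷ 2 ∷ []) ∷
      (5 ∷ 0 ∷ 1 ∷ 4 ∷ 3 ∷ []) ∷
      (2 ∷ 3 ∷ 5 ∷ 0 ∷ 1 ∷ []) ∷
      []

  tail12 : Vec (Vec (Fin 6) 5) 12
  tail12 =
      (0 ∷ 1 ∷ 2 ∷ 3 ∷ 4 ∷ []) ∷
      (3 ∷ 4 ∷ 0 ∷ 1 ∷ 2 ∷ []) ∷
      (1 ∷ 2 ∷ 3 ∷ 4 ∷ 5 ∷ []) ∷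
      (4 ∷ 5 ∷ 1 ∷ 0 ∷ 3 ∷ []) ∷
      (0 ∷ 0 ∷ 4 ∷ 5 ∷ 1 ∷ []) ∷
      (5 ∷ 1 ∷ 2 ∷ 2 ∷ 4 ∷ []) ∷
      (2 ∷ 4 ∷ 5 ∷ 3 ∷ 3 ∷ []) ∷
      (1 ∷ 3 ∷ 0 ∷ 0 ∷ 5 ∷ []) ∷
      (0 ∷ 5 ∷ 4 ∷ 1 ∷ 2 ∷ []) ∷
      (4 ∷ 2 ∷ 3 ∷ 5 ∷ 4 ∷ []) ∷
      (5 ∷ 0 ∷ 1 ∷ 2 ∷ 3 ∷ []) ∷
      (2 ∷ 3 ∷ 5 ∷ 0 ∷ 1 ∷ []) ∷
      []

  tail13 : Vec (Vec (Fin 6) 5) 13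
  tail13 =
      (0 ∷ 1 ∷ 2 ∷ 3 ∷ 4 ∷ []) ∷
      (3 ∷ 4 ∷ 0 ∷ 1 ∷ 2 ∷ []) ∷
      (1 ∷ 2 ∷ 3 ∷ 4 ∷ 0 ∷ []) ∷
      (4 ∷ 0 ∷ 1 ∷ 2 ∷ 5 ∷ []) ∷
      (2 ∷ 5 ∷ 4 ∷ 0 ∷ 1 ∷ []) ∷
      (0 ∷ 1 ∷ 3 ∷ 5 ∷ 4 ∷ []) ∷
      (5 ∷ 2 ∷ 0 ∷ 1 ∷ 3 ∷ []) ∷
      (4 ∷ 3 ∷ 5 ∷ 2 ∷ 0 ∷ []) ∷
      (2 ∷ 0 ∷ 4 ∷ 3 ∷ 5 ∷ []) ∷
      (3 ∷ 5 ∷ 2 ∷ 1 ∷ 4 ∷ []) ∷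
      (1 ∷ 4 ∷ 3 ∷ 5 ∷ 2 ∷ []) ∷
      (5 ∷ 0 ∷ 1 ∷ 4 ∷ 3 ∷ []) ∷
      (2 ∷ 3 ∷ 5 ∷ 0 ∷ 1 ∷ []) ∷
      []

  tail16 : Vec (Vec (Fin 6) 5) 16
  tail16 =
      (0 ∷ 1 ∷ 2 ∷ 3 ∷ 4 ∷ []) ∷
      (3 ∷ 4 ∷ 0 ∷ 1 ∷ 2 ∷ []) ∷
      (1 ∷ 2 ∷ 3 ∷ 4 ∷ 0 ∷ []) ∷
      (4 ∷ 0 ∷ 1 ∷ 2 ∷ 3 ∷ []) ∷
      (2 ∷ 3 ∷ 4 ∷ 0 ∷ 1 ∷ []) ∷
      (0 ∷ 1 ∷ 2 ∷ 3 ∷ 4 ∷ []) ∷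
      (3 ∷ 4 ∷ 0 ∷ 1 ∷ 5 ∷ []) ∷
      (1 ∷ 5 ∷ 3 ∷ 4 ∷ 0 ∷ []) ∷
      (4 ∷ 2 ∷ 1 ∷ 5 ∷ 3 ∷ []) ∷
      (5 ∷ 3 ∷ 4 ∷ 2 ∷ 1 ∷ []) ∷
      (2 ∷ 1 ∷ 5 ∷ 0 ∷ 4 ∷ []) ∷
      (0 ∷ 4 ∷ 2 ∷ 1 ∷ 5 ∷ []) ∷
      (3 ∷ 5 ∷ 0 ∷ 4 ∷ 2 ∷ []) ∷
      (4 ∷ 2 ∷ 3 ∷ 5 ∷ 0 ∷ []) ∷
      (5 ∷ 0 ∷ 1 ∷ 2 ∷ 3 ∷ []) ∷
      (2 ∷ 3 ∷ 5 ∷ 0 ∷ 1 ∷ []) ∷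
      []

open Tables using (columns6; columns7; columns8; columns11; block; tail9; tail12; tail13; tail16)

labeling6 : ∀ m → HasL11 (Path m ⊗ Cycle 6) 5
labeling6 = cyclic-labeling columns6 _

labeling7 : ∀ m → HasL11 (Path m ⊗ Cycle 7) 5
labeling7 = cyclic-labeling columns7 _

labeling8 : ∀ m → HasL11 (Path m ⊗ Cycle 8) 5
labeling8 = cyclic-labeling columns8 _

labeling11 : ∀ m → HasL11 (Path m ⊗ Cycle 11) 5
labeling11 = cyclic-labeling columns11 _

labeling9 : ∀ a m → HasL11 (Path m ⊗ Cycle (9 + a * 5)) 5
labeling9 = Family.family-labeling block 8 tail9 _

labeling12 : ∀ a m → HasL11 (Path m ⊗ Cycle (12 + a * 5)) 5
labeling12 = Family.family-labeling block 11 tail12 _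

labeling13 : ∀ a m → HasL11 (Path m ⊗ Cycle (13 + a * 5)) 5
labeling13 = Family.family-labeling block 12 tail13 _

labeling16 : ∀ a m → HasL11 (Path m ⊗ Cycle (16 + a * 5)) 5
labeling16 = Family.family-labeling block 15 tail16 _

six-labels-suffice : ∀ m n → 6 ≤ n → n % 5 ≢ 0 → HasL11 (Path m ⊗ Cycle n) 5
six-labels-suffice m n 6≤n n≢0 =
  subst (λ n → HasL11 (Path m ⊗ Cycle n) 5) (sym n≡r+q*5)
    (by-residue (n % 5) (n / 5) (m%n<n n 5) n≢0 (subst (6 ≤_) n≡r+q*5 6≤n))
  where
  n≡r+q*5 : n ≡ n % 5 + n / 5 * 5
  n≡r+q*5 = m≡m%n+[m/n]*n n 5
  by-residue : ∀ r q → r < 5 → r ≢ 0 → 6 ≤ r + q * 5 → HasL11 (Path m ⊗ Cycle (r + q * 5)) 5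
  by-residue 0 _                   _ r≢0 _ = contradiction refl r≢0
  by-residue 1 0                   _ _ (s≤s ())
  by-residue 1 1                   _ _ _ = labeling6 m
  by-residue 1 2                   _ _ _ = labeling11 m
  by-residue 1 (suc (suc (suc a))) _ _ _ = labeling16 a m
  by-residue 2 0                   _ _ (s≤s (s≤s ()))
  by-residue 2 1                   _ _ _ = labeling7 m
  by-residue 2 (suc (suc a))       _ _ _ = labeling12 a m
  by-residue 3 0                   _ _ (s≤s (s≤s (s≤s ())))
  by-residue 3 1                   _ _ _ = labeling8 m
  by-residue 3 (suc (suc a))       _ _ _ = labeling13 a m
  by-residue 4 0                   _ _ (s≤s (s≤s (s≤s (s≤s ()))))
  by-residue 4 (suc a)             _ _ _ = labeling9 a m
  by-residue (suc (suc (suc (suc (suc _))))) _ (s≤s (s≤s (s≤s (s≤s (s≤s ()))))) _ _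

-- Five labels are not enough

Fresh : ℕ → List ℕ → Set
Fresh x ys = All (x ≢_) ys

fresh? : ∀ x ys → Dec (Fresh x ys)
fresh? x ys = All.all? (λ y → ¬? (x ≟ y)) ys

ForallFresh : List ℕ → (ℕ → Set) → Set
ForallFresh ys P = All P (filter (λ x → fresh? x ys) (upTo 5))

forallFresh-elim : ∀ {ys P x} → ForallFresh ys P → x < 5 → Fresh x ys → P x
forallFresh-elim {ys} h x<5 fresh = All.lookup h (∈-filter⁺ (λ x → fresh? x ys) (∈-upTo⁺ x<5) fresh)

-- The labels of rows 0, 2, 4 in a column j and of rows 1, 3 in column j + 1.
record Zigzag : Set where
  constructor zz
  field r₀ r₂ r₄ r₁ r₃ : ℕ
open Zigzag public

Bounded : Zigzag → Set
Bounded (zz a b c d e) = a < 5 × b < 5 × c < 5 × d < 5 × e < 5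

Proper : Zigzag → Set
Proper (zz a b c d e) =
  Fresh b (a ∷ []) × Fresh c (b ∷ []) × Fresh d (a ∷ b ∷ []) × Fresh e (b ∷ c ∷ d ∷ [])

-- Each label of the zigzag two columns further on avoids the labels at distance at most 2
-- that precede it in the order r₀, r₂, r₄, r₁, r₃.
Step : Zigzag → Zigzag → Set
Step (zz a b c d e) (zz A B C D E) =
  Fresh A (d ∷ a ∷ b ∷ []) × Fresh B (d ∷ e ∷ a ∷ b ∷ c ∷ A ∷ []) ×
  Fresh C (e ∷ b ∷ c ∷ B ∷ []) × Fresh D (d ∷ e ∷ A ∷ B ∷ []) ×
  Fresh E (d ∷ e ∷ B ∷ C ∷ D ∷ [])

Settles : ℕ → ℕ → Zigzag → Set
Settles zero    t z = r₀ z ≡ t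
Settles (suc k) t (zz a b c d e) =
  ForallFresh (d ∷ a ∷ b ∷ []) λ A →
  ForallFresh (d ∷ e ∷ a ∷ b ∷ c ∷ A ∷ []) λ B →
  ForallFresh (e ∷ b ∷ c ∷ B ∷ []) λ C →
  ForallFresh (d ∷ e ∷ A ∷ B ∷ []) λ D →
  ForallFresh (d ∷ e ∷ B ∷ C ∷ D ∷ []) λ E →
  Settles k t (zz A B C D E)

settles? : ∀ k t z → Dec (Settles k t z)
settles? zero    t z              = r₀ z ≟ t
settles? (suc k) t (zz a b c d e) =
  All.all? (λ A → All.all? (λ B → All.all? (λ C → All.all? (λ D → All.all? (λ E →
    settles? k t (zz A B C D E)) _) _) _) _) _

settles-step : ∀ {k t z z′} → Settles (suc k) t z → Bounded z′ → Step z z′ → Settles k t z′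
settles-step {z = zz _ _ _ _ _} {zz _ _ _ _ _} h (A<5 , B<5 , C<5 , D<5 , E<5) (fA , fB , fC , fD , fE) =
  forallFresh-elim (forallFresh-elim (forallFresh-elim (forallFresh-elim (forallFresh-elim h
    A<5 fA) B<5 fB) C<5 fC) D<5 fD) E<5 fE

r₀-returns-after-five : ∀ z → Bounded z → Proper z → Settles 5 (r₀ z) z
r₀-returns-after-five (zz a b c d e) (a<5 , b<5 , c<5 , d<5 , e<5) (fb , fc , fd , fe) =
  forallFresh-elim (forallFresh-elim (forallFresh-elim (forallFresh-elim (forallFresh-elim search
    a<5 []) b<5 fb) c<5 fc) d<5 fd) e<5 fe
  where
  search : ForallFresh [] λ a → ForallFresh (a ∷ []) λ b → ForallFresh (b ∷ []) λ c →
           ForallFresh (a ∷ b ∷ []) λ d → ForallFresh (b ∷ c ∷ d ∷ []) λ e →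
           Settles 5 a (zz a b c d e)
  search = toWitness {a? = All.all? (λ a → All.all? (λ b → All.all? (λ c → All.all? (λ d →
    All.all? (λ e → settles? 5 a (zz a b c d e)) _) _) _) _) _} _

module FiveLabels (m n p : ℕ) (p≤4 : p ≤ 4)
  (l : V (Path (5 + m) ⊗ Cycle (3 + n)) → Fin (suc p))
  (l-ok : IsL11Labeling (Path (5 + m) ⊗ Cycle (3 + n)) p l) where

  N : ℕ
  N = 3 + n

  G : Graph
  G = Path (5 + m) ⊗ Cycle N

  _~_ : Fin (5 + m) → Fin (5 + m) → Set
  _~_ = Adj (Path (5 + m))

  ~-irrefl : ∀ {r r′} → r ~ r′ → r ≢ r′
  ~-irrefl (inj₁ eq) refl = <⇒≢ (n<1+n _) (sym eq)
  ~-irrefl (inj₂ eq) refl = <⇒≢ (n<1+n _) (sym eq)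

  column-step : ∀ j → Adj (Cycle N) (j mod N) (suc j mod N)
  column-step j = inj₁ (begin
    suc (toℕ (j mod N)) % N  ≡⟨ cong (λ x → suc x % N) (toℕ-fromℕ< (m%n<n j N)) ⟩
    suc (j % N) % N          ≡⟨ [m+n%d]%d≡[m+n]%d 1 j N ⟩
    suc j % N                ≡⟨ toℕ-fromℕ< (m%n<n (suc j) N) ⟨
    toℕ (suc j mod N)        ∎)
    where open ≡-Reasoning

  columns-apart : ∀ j → j mod N ≢ (2 + j) mod N
  columns-apart j eq = [m+n]%d≢n {2} {j % N} {N} z<s (s≤s (s≤s z<s)) (m%n<n j N) (begin
    (2 + j % N) % N     ≡⟨ [m+n%d]%d≡[m+n]%d 2 j N ⟩
    (2 + j) % N         ≡⟨ toℕ-fromℕ< (m%n<n (2 + j) N) ⟨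
    toℕ ((2 + j) mod N) ≡⟨ cong toℕ eq ⟨
    toℕ (j mod N)       ≡⟨ toℕ-fromℕ< (m%n<n j N) ⟩
    j % N               ∎)
    where open ≡-Reasoning

  L : Fin (5 + m) → ℕ → ℕ
  L r j = toℕ (l (r , j mod N))

  L<5 : ∀ r j → L r j < 5
  L<5 r j = <-≤-trans (toℕ<n (l (r , j mod N))) (s≤s p≤4)

  L-mod : ∀ {r j j′} → j % N ≡ j′ % N → L r j ≡ L r j′
  L-mod {r} {j} {j′} eq = cong (λ c → toℕ (l (r , c))) (fromℕ<-cong _ _ eq (m%n<n j N) (m%n<n j′ N))

  distinct : ∀ {u v} → Within2 G u v → toℕ (l v) ≢ toℕ (l u)
  distinct w eq = l-ok _ _ w (toℕ-injective (sym eq))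

  adjacent : ∀ {r r′} → r ~ r′ → ∀ j → L r′ (suc j) ≢ L r j
  adjacent r~r′ j = distinct ((λ eq → ~-irrefl r~r′ (cong proj₁ eq)) , inj₁ (r~r′ , column-step j))

  vertical : ∀ {r r′ r″} → r ~ r′ → r′ ~ r″ → r ≢ r″ → ∀ j → L r″ j ≢ L r j
  vertical r~r′ r′~r″ r≢r″ j = distinct ((λ eq → r≢r″ (cong proj₁ eq)) ,
    inj₂ ((_ , suc j mod N) , (r~r′ , column-step j) , (r′~r″ , swap (column-step j))))

  across : ∀ {r r′ r″} → r ~ r′ → r′ ~ r″ → ∀ j → L r″ (2 + j) ≢ L r j
  across r~r′ r′~r″ j = distinct ((λ eq → columns-apart j (cong proj₂ eq)) ,
    inj₂ ((_ , suc j mod N) , (r~r′ , column-step j) , (r′~r″ , column-step (suc j))))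

  pattern ↑ = inj₁ refl
  pattern ↓ = inj₂ refl

  zigzag : ℕ → Zigzag
  zigzag j = zz (L (# 0) j) (L (# 2) j) (L (# 4) j) (L (# 1) (suc j)) (L (# 3) (suc j))

  zigzag-bounded : ∀ j → Bounded (zigzag j)
  zigzag-bounded j = L<5 _ j , L<5 _ j , L<5 _ j , L<5 _ (suc j) , L<5 _ (suc j)

  zigzag-proper : ∀ j → Proper (zigzag j)
  zigzag-proper j =
    (vertical ↑ ↑ (λ ()) j ∷ []) ,
    (vertical ↑ ↑ (λ ()) j ∷ []) ,
    (adjacent ↑ j ∷ adjacent ↓ j ∷ []) ,
    (adjacent ↑ j ∷ adjacent ↓ j ∷ vertical ↑ ↑ (λ ()) (suc j) ∷ [])

  zigzag-step : ∀ j → Step (zigzag j) (zigzag (2 + j))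
  zigzag-step j =
    (adjacent ↓ (suc j) ∷ across ↑ ↓ j ∷ across ↓ ↓ j ∷ []) ,
    (adjacent ↑ (suc j) ∷ adjacent ↓ (suc j) ∷
      across ↑ ↑ j ∷ across ↓ ↑ j ∷ across ↓ ↓ j ∷ vertical ↑ ↑ (λ ()) (2 + j) ∷ []) ,
    (adjacent ↑ (suc j) ∷ across ↑ ↑ j ∷ across ↓ ↑ j ∷ vertical ↑ ↑ (λ ()) (2 + j) ∷ []) ,
    (across ↑ ↓ (suc j) ∷ across ↓ ↓ (suc j) ∷ adjacent ↑ (2 + j) ∷ adjacent ↓ (2 + j) ∷ []) ,
    (across ↑ ↑ (suc j) ∷ across ↓ ↑ (suc j) ∷
      adjacent ↑ (2 + j) ∷ adjacent ↓ (2 + j) ∷ vertical ↑ ↑ (λ ()) (3 + j) ∷ [])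

  settles-along : ∀ k j {t} → Settles k t (zigzag j) → L (# 0) (k * 2 + j) ≡ t
  settles-along zero    j h = h
  settles-along (suc k) j h =
    trans (cong (L (# 0)) (sym (trans (+-suc (k * 2) (suc j)) (cong suc (+-suc (k * 2) j)))))
      (settles-along k (2 + j) (settles-step h (zigzag-bounded (2 + j)) (zigzag-step j)))

  row₀-period : ∀ j → L (# 0) (10 + j) ≡ L (# 0) j
  row₀-period j =
    settles-along 5 j (r₀-returns-after-five (zigzag j) (zigzag-bounded j) (zigzag-proper j))

  row₀-period-multiple : ∀ t → L (# 0) (t * 10) ≡ L (# 0) 0
  row₀-period-multiple zero    = refl
  row₀-period-multiple (suc t) = trans (row₀-period (t * 10)) (row₀-period-multiple t)

  ten-not-two : ∀ t → (t * 10) % N ≢ 2 % N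
  ten-not-two t eq = across ↑ ↓ 0 (trans (L-mod {j = 2} {t * 10} (sym eq)) (row₀-period-multiple t))

ten-hits-two : ∀ n .{{_ : NonZero n}} → n % 5 ≢ 0 → ∃[ t ] (t * 10) % n ≡ 2 % n
ten-hits-two n n≢0 = by-residue (n % 5) (n / 5) (m%n<n n 5) n≢0 (m≡m%n+[m/n]*n n 5)
  where
  -- t = (2 + s n) / 10, where s r ≡ 8 (mod 10) for the residue r of n.
  hit : ∀ t s → t * 10 ≡ 2 + s * n → ∃[ t ] (t * 10) % n ≡ 2 % n
  hit t s eq = t , trans (cong (_% n) eq) ([m+kn]%n≡m%n 2 s n)
  identity₁ : ∀ q → (4 * q + 1) * 10 ≡ 2 + 8 * (1 + q * 5)
  identity₁ = solve-∀
  identity₂ : ∀ q → (2 * q + 1) * 10 ≡ 2 + 4 * (2 + q * 5)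
  identity₂ = solve-∀
  identity₃ : ∀ q → (3 * q + 2) * 10 ≡ 2 + 6 * (3 + q * 5)
  identity₃ = solve-∀
  identity₄ : ∀ q → (q + 1) * 10 ≡ 2 + 2 * (4 + q * 5)
  identity₄ = solve-∀
  by-residue : ∀ r q → r < 5 → r ≢ 0 → n ≡ r + q * 5 → ∃[ t ] (t * 10) % n ≡ 2 % n
  by-residue 0 q _ r≢0 _ = contradiction refl r≢0
  by-residue 1 q _ _ eq = hit (4 * q + 1) 8 (trans (identity₁ q) (cong (λ x → 2 + 8 * x) (sym eq)))
  by-residue 2 q _ _ eq = hit (2 * q + 1) 4 (trans (identity₂ q) (cong (λ x → 2 + 4 * x) (sym eq)))
  by-residue 3 q _ _ eq = hit (3 * q + 2) 6 (trans (identity₃ q) (cong (λ x → 2 + 6 * x) (sym eq)))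
  by-residue 4 q _ _ eq = hit (q + 1) 2 (trans (identity₄ q) (cong (λ x → 2 + 2 * x) (sym eq)))
  by-residue (suc (suc (suc (suc (suc _))))) _ (s≤s (s≤s (s≤s (s≤s (s≤s ()))))) _ _

five-labels-fail : ∀ m n p → 5 ≤ m → 3 ≤ n → n % 5 ≢ 0 → p ≤ 4 → ¬ HasL11 (Path m ⊗ Cycle n) p
five-labels-fail _ _ p (s≤s (s≤s (s≤s (s≤s (s≤s (z≤n {m}))))))
                 (s≤s (s≤s (s≤s (z≤n {n})))) n≢0 p≤4 (l , l-ok) =
  let t , 10t≡2 = ten-hits-two (3 + n) n≢0 in FiveLabels.ten-not-two m n p p≤4 l l-ok t 10t≡2

mainTheorem20 : (m n : ℕ) → 5 ≤ m → 6 ≤ n → n % 5 ≢ 0 →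
    λ11≡ (Path m ⊗ Cycle n) 5
mainTheorem20 m n 5≤m 6≤n n≢0 =
  six-labels-suffice m n 6≤n n≢0 ,
  λ p p<5 → five-labels-fail m n p 5≤m (m+n≤o⇒n≤o 3 6≤n) n≢0 (s≤s⁻¹ p<5)
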